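{- For every mass problem $\mathcal{F}\subseteq2^\omega$, the Medvedev degree $\deg_M(\mathcal{F})=\{\mathcal{A}\subseteq\omega^\omega:\mathcal{A}\equiv_M\mathcal{F}\}$ has cardinality $2^{2^{\aleph_0}}$.
   Context: A mass problem is a subset of $\omega^\omega$. $\mathcal{A}\leq_M\mathcal{B}$ means there is a partial computable functional $\Psi$ defined on all of $\mathcal{B}$ with $\Psi(\mathcal{B})\subseteq\mathcal{A}$; $\mathcal{A}\equiv_M\mathcal{B}$ means both $\mathcal{A}\leq_M\mathcal{B}$ and $\mathcal{B}\leq_M\mathcal{A}$. -}

module Defs where

open import Level using (Level) renaming (suc to lsuc; zero to lzero)
open import Data.Nat using (ℕ; zero; suc; _<_)
open import Data.Bool using (Bool)
open import Data.Fin using (Fin)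
open import Data.Vec using (Vec; []; _∷_; lookup)
open import Data.Product using (Σ; ∃; _×_; _,_; proj₁; proj₂)
open import Relation.Binary.PropositionalEquality using (_≡_)
open import Relation.Binary.Bundles using (Setoid)
open import Relation.Binary.Structures using (IsEquivalence)

Baire : Set
Baire = ℕ → ℕ

Cantor : Set
Cantor = ℕ → Bool

_≈ᴮ_ : Baire → Baire → Set
f ≈ᴮ g = ∀ n → f n ≡ g n

_≈ᶜ_ : Cantor → Cantor → Set
x ≈ᶜ y = ∀ n → x n ≡ y n

-- Functions primitive recursive relative to an oracle f : ω^ω.
-- PR n = programs of arity n.

data PR : ℕ → Set where
  pzero   : ∀ {n} → PR n
  psucc   : PR 1
  pproj   : ∀ {n} → Fin n → PR n
  poracle : PR 1
  pcomp   : ∀ {m n} → PR m → Vec (PR n) m → PR n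
  prec    : ∀ {n} → PR n → PR (suc (suc n)) → PR (suc n)

module _ (f : Baire) where
  mutual
    eval : ∀ {n} → PR n → Vec ℕ n → ℕ
    eval pzero        xs           = 0
    eval psucc        (x ∷ [])     = suc x
    eval (pproj i)    xs           = lookup xs i
    eval poracle      (x ∷ [])     = f x
    eval (pcomp g hs) xs           = eval g (evalVec hs xs)
    eval (prec g h)   (k ∷ xs)     = evalRec g h k xs

    evalVec : ∀ {m n} → Vec (PR n) m → Vec ℕ n → Vec ℕ m
    evalVec []       xs = []
    evalVec (h ∷ hs) xs = eval h xs ∷ evalVec hs xs

    evalRec : ∀ {n} → PR n → PR (suc (suc n)) → ℕ → Vec ℕ n → ℕ
    evalRec g h zero    xs = eval g xs
    evalRec g h (suc k) xs = eval h (k ∷ evalRec g h k xs ∷ xs)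

-- Partial computable functionals (Kleene normal form, uniform in the
-- oracle): a program P : PR 2 defines
--   Ψ_P(f)(n) = m  iff  P^f(n,s) = m+1 for the least s with P^f(n,s) ≠ 0.

Functional : Set
Functional = PR 2

_⟨_⟩_↓_ : Functional → Baire → ℕ → ℕ → Set
Ψ ⟨ f ⟩ n ↓ m =
  ∃ λ s → (eval f Ψ (n ∷ s ∷ []) ≡ suc m)
        × (∀ t → t < s → eval f Ψ (n ∷ t ∷ []) ≡ 0)

-- Mass problems: subsets of ω^ω (predicates closed under pointwise
-- equality of sequences, i.e. genuine subsets of ω^ω).

record MassProblem : Set₁ where
  field
    member   : Baire → Set
    respects : ∀ {f g} → f ≈ᴮ g → member f → member g
open MassProblem public

_∈ᴹ_ : Baire → MassProblem → Set
f ∈ᴹ A = member A f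

_≤M_ : MassProblem → MassProblem → Set
A ≤M B = ∃ λ (Ψ : Functional) →
  ∀ f → f ∈ᴹ B → ∃ λ (g : Baire) → (∀ n → Ψ ⟨ f ⟩ n ↓ g n) × (g ∈ᴹ A)

_≡M_ : MassProblem → MassProblem → Set
A ≡M B = (A ≤M B) × (B ≤M A)

_≐ᴹ_ : MassProblem → MassProblem → Set
A ≐ᴹ B = ∀ f → (f ∈ᴹ A → f ∈ᴹ B) × (f ∈ᴹ B → f ∈ᴹ A)

SubsetOfCantor : MassProblem → Set
SubsetOfCantor F = ∀ f → f ∈ᴹ F → ∀ n → f n < 2

Deg : MassProblem → Setoid (lsuc lzero) lzero
Deg F = record
  { Carrier       = Σ MassProblem (λ A → A ≡M F)
  ; _≈_           = λ A B → proj₁ A ≐ᴹ proj₁ B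
  ; isEquivalence = record
      { refl  = λ f → (λ p → p) , (λ p → p)
      ; sym   = λ e f → proj₂ (e f) , proj₁ (e f)
      ; trans = λ e e' f → (λ p → proj₁ (e' f) (proj₁ (e f) p))
                         , (λ p → proj₂ (e f) (proj₂ (e' f) p))
      }
  }

-- P(2^ω), the power set of Cantor space (cardinality 2^(2^ℵ₀)),
-- as a setoid with extensional equality of subsets.

record CantorSubset : Set₁ where
  field
    cmember   : Cantor → Set
    crespects : ∀ {x y} → x ≈ᶜ y → cmember x → cmember y
open CantorSubset public

PowerCantor : Setoid (lsuc lzero) lzero
PowerCantor = record
  { Carrier       = CantorSubset
  ; _≈_           = λ X Y → ∀ x → (cmember X x → cmember Y x) × (cmember Y x → cmember X x)
  ; isEquivalence = record
      { refl  = λ x → (λ p → p) , (λ p → p)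
      ; sym   = λ e x → proj₂ (e x) , proj₁ (e x)
      ; trans = λ e e' x → (λ p → proj₁ (e' x) (proj₁ (e x) p))
                         , (λ p → proj₂ (e x) (proj₂ (e' x) p))
      }
  }

{-# OPTIONS --safe #-}
-- Sending a mass problem A to the set of graphs of its members embeds deg_M(F) into
-- P(2^ω). Conversely, send X ⊆ 2^ω to A_X = F ∪ {tagged x g : x ∈ X, g ∈ F}, where
-- (tagged x g)(n) = 2(1 + x(n)) + g(n). Since F ⊆ 2^ω, reducing values mod 2 fixes F
-- pointwise and strips the tags, so F ≤M A_X; and A_X ≤M F by the identity, as F ⊆ A_X.
-- Tagged sequences lie outside 2^ω and x is read off (tagged x g)(n) / 2, so A_X
-- determines X as soon as F is nonempty.
module Submission where

open import Defs
open import Data.Bool using (Bool; true; false; T)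
open import Data.Empty using (⊥-elim)
open import Data.Fin using () renaming (zero to #0; suc to #suc)
open import Data.Nat using (ℕ; zero; suc; _+_; _*_; _<_; _≡ᵇ_; NonZero; s≤s)
open import Data.Nat.DivMod using (_%_; _/_; %-remove-+ˡ; m<n⇒m%n≡m; +-distrib-/-∣ˡ; m*n/n≡m; m<n⇒m/n≡0; m%n<n)
open import Data.Nat.Divisibility using (n∣m*n)
open import Data.Nat.Properties using (+-identityʳ; +-suc; suc-injective; m+n≮m; ≡ᵇ⇒≡; ≡⇒≡ᵇ)
open import Data.Product using (∃; ∃₂; _×_; _,_; proj₁; proj₂; uncurry)
open import Data.Sum using (_⊎_; inj₁; inj₂)
open import Data.Vec using ([]; _∷_)
open import Function using (_∘_)
open import Function.Bundles using (Injection)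
open import Relation.Nullary using (¬_)
open import Relation.Binary.PropositionalEquality using (_≡_; refl; sym; trans; cong; subst; module ≡-Reasoning)

_⊆ᴹ_ : MassProblem → MassProblem → Set
A ⊆ᴹ B = ∀ f → f ∈ᴹ A → f ∈ᴹ B

_⊆ᶜ_ : CantorSubset → CantorSubset → Set
X ⊆ᶜ Y = ∀ x → cmember X x → cmember Y x

[kn+m]%n≡m : ∀ k {m n} .{{_ : NonZero n}} → m < n → (k * n + m) % n ≡ m
[kn+m]%n≡m k {m} {n} m<n = trans (%-remove-+ˡ m (n∣m*n k)) (m<n⇒m%n≡m m<n)

[kn+m]/n≡k : ∀ k {m n} .{{_ : NonZero n}} → m < n → (k * n + m) / n ≡ k
[kn+m]/n≡k k {m} {n} m<n = begin
  (k * n + m) / n    ≡⟨ +-distrib-/-∣ˡ m (n∣m*n k) ⟩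
  k * n / n + m / n  ≡⟨ cong (_+ m / n) (m*n/n≡m k n) ⟩
  k + m / n          ≡⟨ cong (k +_) (m<n⇒m/n≡0 m<n) ⟩
  k + 0              ≡⟨ +-identityʳ k ⟩
  k                  ∎
  where open ≡-Reasoning

pointwise : PR 1 → Functional
pointwise p = pcomp psucc (pcomp p (pcomp poracle (pproj #0 ∷ []) ∷ []) ∷ [])

pointwise-reduction : ∀ {A B} (p : PR 1) →
  (∀ f → f ∈ᴹ B → (λ n → eval f p (f n ∷ [])) ∈ᴹ A) → A ≤M B
pointwise-reduction p red = pointwise p , λ f f∈B → _ , (λ n → 0 , refl , λ _ ()) , red f f∈B

isZero : PR 1
isZero = prec (pcomp psucc (pzero ∷ [])) pzero

parity : PR 1
parity = prec pzero (pcomp isZero (pproj (#suc #0) ∷ []))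

eval-isZero-involutive : ∀ f {k} → k < 2 → eval f isZero (eval f isZero (k ∷ []) ∷ []) ≡ k
eval-isZero-involutive f {0} _ = refl
eval-isZero-involutive f {1} _ = refl
eval-isZero-involutive f {suc (suc _)} (s≤s (s≤s ()))

eval-parity : ∀ f n → eval f parity (n ∷ []) ≡ n % 2
eval-parity f zero = refl
eval-parity f (suc zero) = refl
-- (2 + n) % 2 reduces to n % 2 definitionally.
eval-parity f (suc (suc n)) = begin
  eval f isZero (eval f isZero (eval f parity (n ∷ []) ∷ []) ∷ [])
    ≡⟨ cong (λ k → eval f isZero (eval f isZero (k ∷ []) ∷ [])) (eval-parity f n) ⟩
  eval f isZero (eval f isZero (n % 2 ∷ []) ∷ [])
    ≡⟨ eval-isZero-involutive f (m%n<n n 2) ⟩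
  n % 2 ∎
  where open ≡-Reasoning

bit : Bool → ℕ
bit false = 0
bit true  = 1

bit-injective : ∀ {b c} → bit b ≡ bit c → b ≡ c
bit-injective {false} {false} _ = refl
bit-injective {true}  {true}  _ = refl

tagged : Cantor → Baire → Baire
tagged x g n = suc (bit (x n)) * 2 + g n

tagged-≮2 : ∀ x g n → ¬ tagged x g n < 2
tagged-≮2 x g n = m+n≮m 2 (bit (x n) * 2 + g n)

tagged-%2 : ∀ x {g} → (∀ n → g n < 2) → ∀ n → tagged x g n % 2 ≡ g n
tagged-%2 x g<2 n = [kn+m]%n≡m (suc (bit (x n))) (g<2 n)

tagged-injectiveˡ : ∀ {x y g g'} → (∀ n → g n < 2) → (∀ n → g' n < 2) →
                    tagged x g ≈ᴮ tagged y g' → x ≈ᶜ y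
tagged-injectiveˡ {x} {y} {g} {g'} g<2 g'<2 xg≈yg' n = bit-injective (suc-injective (begin
  suc (bit (x n))    ≡⟨ sym ([kn+m]/n≡k _ (g<2 n)) ⟩
  tagged x g n / 2   ≡⟨ cong (_/ 2) (xg≈yg' n) ⟩
  tagged y g' n / 2  ≡⟨ [kn+m]/n≡k _ (g'<2 n) ⟩
  suc (bit (y n))    ∎))
  where open ≡-Reasoning

module _ (F : MassProblem) where

  IsTagged : CantorSubset → Baire → Set
  IsTagged X h = ∃₂ λ x g → cmember X x × g ∈ᴹ F × h ≈ᴮ tagged x g

  F∪tagged : CantorSubset → MassProblem
  F∪tagged X = record { member = λ h → h ∈ᴹ F ⊎ IsTagged X h ; respects = respects-∪ }
    where
    respects-∪ : ∀ {h h'} → h ≈ᴮ h' → h ∈ᴹ F ⊎ IsTagged X h → h' ∈ᴹ F ⊎ IsTagged X h'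
    respects-∪ h≈h' (inj₁ h∈F) = inj₁ (respects F h≈h' h∈F)
    respects-∪ h≈h' (inj₂ (x , g , x∈X , g∈F , h≈xg)) =
      inj₂ (x , g , x∈X , g∈F , λ n → trans (sym (h≈h' n)) (h≈xg n))

  F∪tagged≤F : ∀ X → F∪tagged X ≤M F
  F∪tagged≤F X = pointwise-reduction {F∪tagged X} {F} (pproj #0) (λ _ → inj₁)

  F≤F∪tagged : SubsetOfCantor F → ∀ X → F ≤M F∪tagged X
  F≤F∪tagged F⊆2^ω X = pointwise-reduction {F} {F∪tagged X} parity untag
    where
    untag : ∀ h → h ∈ᴹ F∪tagged X → (λ n → eval h parity (h n ∷ [])) ∈ᴹ F
    untag h (inj₁ h∈F) = respects F (λ n → sym (begin
      eval h parity (h n ∷ [])  ≡⟨ eval-parity h (h n) ⟩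
      h n % 2                   ≡⟨ m<n⇒m%n≡m (F⊆2^ω h h∈F n) ⟩
      h n                       ∎)) h∈F
      where open ≡-Reasoning
    untag h (inj₂ (x , g , _ , g∈F , h≈xg)) = respects F (λ n → sym (begin
      eval h parity (h n ∷ [])  ≡⟨ eval-parity h (h n) ⟩
      h n % 2                   ≡⟨ cong (_% 2) (h≈xg n) ⟩
      tagged x g n % 2          ≡⟨ tagged-%2 x (F⊆2^ω g g∈F) n ⟩
      g n                       ∎)) g∈F
      where open ≡-Reasoning

  F∪tagged-mono : ∀ {X Y} → X ⊆ᶜ Y → F∪tagged X ⊆ᴹ F∪tagged Y
  F∪tagged-mono X⊆Y h (inj₁ h∈F) = inj₁ h∈F
  F∪tagged-mono X⊆Y h (inj₂ (x , g , x∈X , rest)) = inj₂ (x , g , X⊆Y x x∈X , rest)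

  F∪tagged-reflects-⊆ : SubsetOfCantor F → ∀ {f₀} → f₀ ∈ᴹ F →
                        ∀ {X Y} → F∪tagged X ⊆ᴹ F∪tagged Y → X ⊆ᶜ Y
  F∪tagged-reflects-⊆ F⊆2^ω {f₀} f₀∈F {Y = Y} AX⊆AY x x∈X
    with AX⊆AY (tagged x f₀) (inj₂ (x , f₀ , x∈X , f₀∈F , λ _ → refl))
  ... | inj₁ xf₀∈F = ⊥-elim (tagged-≮2 x f₀ 0 (F⊆2^ω _ xf₀∈F 0))
  ... | inj₂ (y , g , y∈Y , g∈F , xf₀≈yg) =
    crespects Y (sym ∘ tagged-injectiveˡ (F⊆2^ω f₀ f₀∈F) (F⊆2^ω g g∈F) xf₀≈yg) y∈Y

  PowerCantor↣Deg : SubsetOfCantor F → ∀ {f₀} → f₀ ∈ᴹ F → Injection PowerCantor (Deg F)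
  PowerCantor↣Deg F⊆2^ω f₀∈F = record
    { to        = λ X → F∪tagged X , F∪tagged≤F X , F≤F∪tagged F⊆2^ω X
    ; cong      = λ {X} {Y} X≐Y h →
        F∪tagged-mono {X} {Y} (proj₁ ∘ X≐Y) h , F∪tagged-mono {Y} {X} (proj₂ ∘ X≐Y) h
    ; injective = λ {X} {Y} AX≐AY x →
        F∪tagged-reflects-⊆ F⊆2^ω f₀∈F {X} {Y} (proj₁ ∘ AX≐AY) x ,
        F∪tagged-reflects-⊆ F⊆2^ω f₀∈F {Y} {X} (proj₂ ∘ AX≐AY) x
    }

next : ℕ × ℕ → ℕ × ℕ
next (zero  , m) = suc m , 0
next (suc n , m) = n , suc m

unpair : ℕ → ℕ × ℕ
unpair zero    = 0 , 0
unpair (suc k) = next (unpair k)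

Enumerated : ℕ × ℕ → Set
Enumerated p = ∃ λ k → unpair k ≡ p

unpair-surjective : ∀ p → Enumerated p
unpair-surjective (n , m) = along-diagonal n m (first-column (n + m))
  where
  enumerated-next : ∀ {p} → Enumerated p → Enumerated (next p)
  enumerated-next (k , unpair-k≡p) = suc k , cong next unpair-k≡p

  along-diagonal : ∀ n m → Enumerated (n + m , 0) → Enumerated (n , m)
  along-diagonal n zero    = subst (λ s → Enumerated (s , 0)) (+-identityʳ n)
  along-diagonal n (suc m) = enumerated-next ∘ along-diagonal (suc n) m
                           ∘ subst (λ s → Enumerated (s , 0)) (+-suc n m)

  first-column : ∀ s → Enumerated (s , 0)
  first-column zero    = 0 , refl
  first-column (suc s) = enumerated-next (along-diagonal 0 s (first-column s))

graph : Baire → Cantor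
graph f = uncurry (_≡ᵇ_ ∘ f) ∘ unpair

graph-injective : ∀ {f g} → graph f ≈ᶜ graph g → f ≈ᴮ g
graph-injective {f} {g} Γf≈Γg n with unpair-surjective (n , f n)
... | k , unpair-k≡nfn = sym (≡ᵇ⇒≡ (g n) (f n) (subst T Γf≡Γg-at-k (≡⇒≡ᵇ (f n) (f n) refl)))
  where
  graph-at-k : ∀ h → graph h k ≡ (h n ≡ᵇ f n)
  graph-at-k h = cong (uncurry (_≡ᵇ_ ∘ h)) unpair-k≡nfn

  Γf≡Γg-at-k : (f n ≡ᵇ f n) ≡ (g n ≡ᵇ f n)
  Γf≡Γg-at-k = trans (sym (graph-at-k f)) (trans (Γf≈Γg k) (graph-at-k g))

graphs : MassProblem → CantorSubset
graphs A = record
  { cmember   = λ x → ∃ λ f → f ∈ᴹ A × x ≈ᶜ graph f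
  ; crespects = λ x≈y (f , f∈A , x≈Γf) → f , f∈A , λ k → trans (sym (x≈y k)) (x≈Γf k)
  }

graphs-mono : ∀ {A B} → A ⊆ᴹ B → graphs A ⊆ᶜ graphs B
graphs-mono A⊆B x (f , f∈A , x≈Γf) = f , A⊆B f f∈A , x≈Γf

graphs-reflects-⊆ : ∀ {A B} → graphs A ⊆ᶜ graphs B → A ⊆ᴹ B
graphs-reflects-⊆ {B = B} ΓA⊆ΓB f f∈A with ΓA⊆ΓB (graph f) (f , f∈A , λ _ → refl)
... | g , g∈B , Γf≈Γg = respects B (sym ∘ graph-injective Γf≈Γg) g∈B

Deg↣PowerCantor : ∀ F → Injection (Deg F) PowerCantor
Deg↣PowerCantor F = record
  { to        = graphs ∘ proj₁
  ; cong      = λ {(A , _)} {(B , _)} A≐B x →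
      graphs-mono {A} {B} (proj₁ ∘ A≐B) x , graphs-mono {B} {A} (proj₂ ∘ A≐B) x
  ; injective = λ {(A , _)} {(B , _)} ΓA≐ΓB f →
      graphs-reflects-⊆ {A} {B} (proj₁ ∘ ΓA≐ΓB) f , graphs-reflects-⊆ {B} {A} (proj₂ ∘ ΓA≐ΓB) f
  }

proposition4p1 : (F : MassProblem) → SubsetOfCantor F → (∃ λ f → f ∈ᴹ F)
    → Injection PowerCantor (Deg F) × Injection (Deg F) PowerCantor
proposition4p1 F F⊆2^ω (_ , f₀∈F) = PowerCantor↣Deg F F⊆2^ω f₀∈F , Deg↣PowerCantor F
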